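{- $\operatorname{Det}(\mathrm{PX}(4,2))=3$, $\operatorname{Dist}(\mathrm{PX}(4,2))=2$, and $\rho(\mathrm{PX}(4,2))=5$.
   Context: For integers $n\ge 3$ and $1\le k<n$, the Praeger–Xu graph $\mathrm{PX}(n,k)$ is the simple graph with vertex set $\mathbb Z_n\times\mathbb Z_2^k$; a vertex is written $(i,x)$ with $x=x_0x_1\cdots x_{k-1}$ a bitstring of length $k$. Two vertices $(i,x)$ and $(j,y)$ are adjacent if and only if (after possibly swapping the two vertices) $j=i+1$ in $\mathbb Z_n$ and $x=az_1\cdots z_{k-1}$, $y=z_1\cdots z_{k-1}b$ for some bits $a,b,z_1,\dots,z_{k-1}\in\mathbb Z_2$. For a graph $G$: $\operatorname{Det}(G)$ is the minimum size of a set $S$ of vertices such that the only automorphism fixing every vertex of $S$ is the identity; $\operatorname{Dist}(G)$ is the least $d$ such that some $d$-coloring of the vertices is preserved (class-wise) only by the identity automorphism; if $\operatorname{Dist}(G)=2$, $\rho(G)$ is the minimum size of a color class over all 2-colorings preserved only by the identity automorphism. -}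

module Defs where

open import Data.Nat using (ℕ; zero; suc; NonZero; _%_)
import Data.Nat
import Data.Empty
open import Data.Fin using (Fin; toℕ)
open import Data.Fin.Properties using () renaming (_≟_ to _≟F_)
open import Data.Bool using (Bool; true; false)
open import Data.Vec using (Vec; []; _∷_; _∷ʳ_)
open import Data.List using (List; []; _∷_; map; concatMap; length; filter; allFin; cartesianProduct)
open import Data.List.Membership.Propositional using (_∈_)
open import Data.List.Relation.Unary.Unique.Propositional using (Unique)
open import Data.Product using (Σ; ∃; _×_; _,_; proj₁)
open import Data.Sum using (_⊎_)
open import Data.Unit using (⊤)
open import Function.Bundles using (_↔_; _⇔_; Inverse)
open import Relation.Binary.PropositionalEquality using (_≡_)

Vertex : ℕ → ℕ → Set
Vertex n k = Fin n × Vec Bool k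

Shift : ∀ {k} → Vec Bool k → Vec Bool k → Set
Shift {zero} x y = ⊤   -- never used: the paper assumes k ≥ 1
Shift {suc m} (a ∷ z) y = Σ Bool λ b → y ≡ z ∷ʳ b

NextMod : (n : ℕ) → Fin n → Fin n → Set
NextMod n i j = (toℕ j ≡ suc (toℕ i)) ⊎ (suc (toℕ i) ≡ n × toℕ j ≡ 0)

Arc : (n k : ℕ) → Vertex n k → Vertex n k → Set
Arc n k (i , x) (j , y) = NextMod n i j × Shift x y

PXAdj : (n k : ℕ) → Vertex n k → Vertex n k → Set
PXAdj n k u v = Arc n k u v ⊎ Arc n k v u

record Automorphism (V : Set) (Adj : V → V → Set) : Set where
  field
    perm     : V ↔ V
  open Inverse perm public using (to)
  field
    preserves : ∀ u v → Adj u v ⇔ Adj (to u) (to v)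

IsIdentity : ∀ {V Adj} → Automorphism V Adj → Set
IsIdentity {V} f = ∀ (v : V) → Automorphism.to f v ≡ v

Determining : (V : Set) (Adj : V → V → Set) → List V → Set
Determining V Adj S = ∀ (f : Automorphism V Adj) →
  (∀ s → s ∈ S → Automorphism.to f s ≡ s) → IsIdentity f

DetEq : (V : Set) (Adj : V → V → Set) → ℕ → Set
DetEq V Adj d =
  (Σ (List V) λ S → Unique S × length S ≡ d × Determining V Adj S) ×
  (∀ (S : List V) → Unique S → Determining V Adj S → d Data.Nat.≤ length S)

Distinguishing : (V : Set) (Adj : V → V → Set) (d : ℕ) → (V → Fin d) → Set
Distinguishing V Adj d c = ∀ (f : Automorphism V Adj) →
  (∀ v → c (Automorphism.to f v) ≡ c v) → IsIdentity f

DistEq : (V : Set) (Adj : V → V → Set) → ℕ → Set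
DistEq V Adj d =
  (Σ (V → Fin d) λ c → Distinguishing V Adj d c) ×
  (∀ d' → d' Data.Nat.< d → (c : V → Fin d') → Distinguishing V Adj d' c → Data.Empty.⊥)

allBits : (k : ℕ) → List (Vec Bool k)
allBits zero = [] ∷ []
allBits (suc k) = concatMap (λ b → map (b ∷_) (allBits k)) (true ∷ false ∷ [])

allVertices : (n k : ℕ) → List (Vertex n k)
allVertices n k = cartesianProduct (allFin n) (allBits k)

classSize : (n k : ℕ) → (Vertex n k → Fin 2) → Fin 2 → ℕ
classSize n k c i = length (filter (λ v → c v ≟F i) (allVertices n k))

RhoEq : (n k : ℕ) → ℕ → Set
RhoEq n k r =
  (Σ (Vertex n k → Fin 2) λ c → Distinguishing (Vertex n k) (PXAdj n k) 2 c ×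
      Σ (Fin 2) λ i → classSize n k c i ≡ r) ×
  (∀ (c : Vertex n k → Fin 2) → Distinguishing (Vertex n k) (PXAdj n k) 2 c →
      ∀ i → r Data.Nat.≤ classSize n k c i)

-- Upper bounds: colour refinement commutes with every automorphism preserving the initial
-- colouring, because such an automorphism permutes the neighbours of v lying in a cell onto
-- the neighbours of its image lying in the same cell (sums over Fin n are invariant under
-- permutations). Starting from the colouring that singles out three pinned vertices, resp.
-- from a red/blue colouring with five red vertices, a few rounds of refinement separate all
-- sixteen vertices, so only the identity preserves the initial colouring.
-- Lower bounds: PX(4,2) has many involutive automorphisms. Every pair of vertices is fixed by
-- a nontrivial one, so no two vertices form a determining set and one colour never suffices;
-- every set of at most four vertices is mapped onto itself by a nontrivial one, so no colour
-- class of a distinguishing 2-colouring has fewer than five vertices.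

module Submission where

open import Defs
open import Data.Bool using (Bool; true; false; _∧_; if_then_else_)
open import Data.Bool.Properties using () renaming (_≟_ to _≟ᵇ_)
open import Data.Empty using (⊥-elim)
open import Data.Fin using (Fin; zero; suc; toℕ; #_)
open import Data.Fin.Permutation using (Permutation′; _⟨$⟩ʳ_; _⟨$⟩ˡ_; inverseˡ)
open import Data.Fin.Properties using (all?; any?; ¬Fin0; *↔×) renaming (_≟_ to _≟ᶠ_)
open import Data.Fin.Subset using (Subset; inside; outside; ∣_∣)
open import Data.List as List using (List; []; _∷_; length; filter)
open import Data.List.Membership.Propositional using (_∈_; _∉_)
open import Data.List.Membership.Propositional.Properties using (∈-map⁻)
open import Data.List.Relation.Unary.All using ([]; _∷_)
open import Data.List.Relation.Unary.AllPairs using ([]; _∷_)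
open import Data.List.Relation.Unary.Any as Any using (Any; here; there)
open import Data.List.Relation.Unary.Unique.Propositional using (Unique)
open import Data.Nat as ℕ using (ℕ; zero; suc; _*_; _^_; _≤_; _<_; z≤n; s≤s)
open import Data.Nat.Properties using (+-0-commutativeMonoid; ≤-pred; ≰⇒>)
open import Algebra.Properties.CommutativeMonoid.Sum +-0-commutativeMonoid using (sum; sum-permute; sum-cong-≗)
open import Data.Product using (Σ; ∃; _×_; _,_; proj₁; proj₂; uncurry)
open import Data.Product.Function.NonDependent.Propositional using (_×-↔_)
open import Data.Product.Properties using () renaming (≡-dec to ×-≡-dec)
open import Data.Unit using (tt)
open import Data.Vec as Vec using (Vec; []; _∷_; _∷ʳ_; lookup; tabulate)
open import Data.Vec.Properties using (≡-dec; lookup∘tabulate; tabulate-cong)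
open import Function using (_∘_; _⇔_; mk⇔)
open import Function.Bundles using (_↔_; Inverse; mk↔ₛ′)
open import Function.Properties.Inverse using (↔-refl; ↔-sym; ↔-trans)
open import Relation.Binary using (Decidable; DecidableEquality)
open import Relation.Binary.PropositionalEquality
open import Relation.Nullary using (Dec; yes; no; does; ¬_; ¬?)
open import Relation.Nullary.Decidable
  using (_⊎-dec_; _×-dec_; _→-dec_; does-⇔; dec-true; dec-false; map′; from-yes; True; toWitness)

does-≡⇒⇔ : ∀ {A B : Set} (a? : Dec A) (b? : Dec B) → does a? ≡ does b? → A ⇔ B
does-≡⇒⇔ (yes a) (yes b) _  = mk⇔ (λ _ → b) (λ _ → a)
does-≡⇒⇔ (no ¬a) (no ¬b) _  = mk⇔ (⊥-elim ∘ ¬a) (⊥-elim ∘ ¬b)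
does-≡⇒⇔ (yes _) (no _)  ()
does-≡⇒⇔ (no _)  (yes _) ()

Fin2-≡-by-membership : ∀ {a b : Fin 2} i → does (a ≟ᶠ i) ≡ does (b ≟ᶠ i) → a ≡ b
Fin2-≡-by-membership {zero}     {zero}     _          _  = refl
Fin2-≡-by-membership {suc zero} {suc zero} _          _  = refl
Fin2-≡-by-membership {zero}     {suc zero} zero       ()
Fin2-≡-by-membership {zero}     {suc zero} (suc zero) ()
Fin2-≡-by-membership {suc zero} {zero}     zero       ()
Fin2-≡-by-membership {suc zero} {zero}     (suc zero) ()

length-filter-tabulate : ∀ {m} {A : Set} {P : A → Set} (P? : ∀ x → Dec (P x)) (f : Fin m → A) →
  length (filter P? (List.tabulate f)) ≡ ∣ tabulate (does ∘ P? ∘ f) ∣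
length-filter-tabulate {zero}  P? f = refl
length-filter-tabulate {suc m} P? f with does (P? (f zero))
... | true  = cong suc (length-filter-tabulate P? (f ∘ suc))
... | false = length-filter-tabulate P? (f ∘ suc)

all-of-size≤? : ∀ {n} {P : Subset n → Set} → (∀ p → Dec (P p)) → ∀ w → Dec (∀ p → ∣ p ∣ ≤ w → P p)
all-of-size≤? {zero}  {P} P? w = map′ (λ P[] → λ { [] _ → P[] }) (λ all → all [] z≤n) (P? [])
all-of-size≤? {suc n} {P} P? w =
  map′ join split (all-of-size≤? {P = P ∘ (outside ∷_)} (P? ∘ (outside ∷_)) w ×-dec withInside w)
  where
    WithOutside WithInside : Set
    WithOutside = ∀ p → ∣ p ∣ ≤ w → P (outside ∷ p)
    WithInside  = ∀ p → suc ∣ p ∣ ≤ w → P (inside ∷ p)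

    withInside : ∀ w → Dec (∀ p → suc ∣ p ∣ ≤ w → P (inside ∷ p))
    withInside zero    = yes λ _ ()
    withInside (suc w) = map′ (λ all p → all p ∘ ≤-pred) (λ all p → all p ∘ s≤s)
      (all-of-size≤? {P = P ∘ (inside ∷_)} (P? ∘ (inside ∷_)) w)

    join : WithOutside × WithInside → ∀ p → ∣ p ∣ ≤ w → P p
    join (out , in′) (outside ∷ p) = out p
    join (out , in′) (inside ∷ p)  = in′ p

    split : (∀ p → ∣ p ∣ ≤ w → P p) → WithOutside × WithInside
    split all = (λ p → all (outside ∷ p)) , (λ p → all (inside ∷ p))

nextMod? : ∀ n (i j : Fin n) → Dec (NextMod n i j)
nextMod? n i j = (toℕ j ℕ.≟ suc (toℕ i)) ⊎-dec ((suc (toℕ i) ℕ.≟ n) ×-dec (toℕ j ℕ.≟ 0))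

shift? : ∀ {k} (x y : Vec Bool k) → Dec (Shift x y)
shift? {zero}  x       y = yes tt
shift? {suc k} (a ∷ z) y with ≡-dec _≟ᵇ_ y (z ∷ʳ true) | ≡-dec _≟ᵇ_ y (z ∷ʳ false)
... | yes y≡z1 | _        = yes (true , y≡z1)
... | no _     | yes y≡z0 = yes (false , y≡z0)
... | no y≢z1  | no y≢z0  = no λ { (true , y≡z1) → y≢z1 y≡z1 ; (false , y≡z0) → y≢z0 y≡z0 }

arc? : ∀ n k → Decidable (Arc n k)
arc? n k (i , x) (j , y) = nextMod? n i j ×-dec shift? x y

pxAdj? : ∀ n k → Decidable (PXAdj n k)
pxAdj? n k u v = arc? n k u v ⊎-dec arc? n k v u

-- true ↦ 0, so that indices enumerate vertices in the order of allVertices.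
bit↔Fin : Bool ↔ Fin 2
bit↔Fin = mk↔ₛ′ (λ { true → zero ; false → suc zero }) (λ { zero → true ; (suc zero) → false })
  (λ { zero → refl ; (suc zero) → refl }) (λ { true → refl ; false → refl })

uncons↔ : ∀ {A : Set} {k} → Vec A (suc k) ↔ (A × Vec A k)
uncons↔ = mk↔ₛ′ Vec.uncons (uncurry _∷_) (λ _ → refl) (λ { (x ∷ xs) → refl })

bits↔Fin : ∀ k → Vec Bool k ↔ Fin (2 ^ k)
bits↔Fin zero    = mk↔ₛ′ (λ _ → zero) (λ _ → []) (λ { zero → refl }) (λ { [] → refl })
bits↔Fin (suc k) = ↔-trans uncons↔ (↔-trans (bit↔Fin ×-↔ bits↔Fin k) (↔-sym *↔×))

vertex↔Fin : ∀ n k → Vertex n k ↔ Fin (n * 2 ^ k)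
vertex↔Fin n k = ↔-trans (↔-refl ×-↔ bits↔Fin k) (↔-sym *↔×)

module ColourRefinement {n : ℕ} (adjacent : Fin n → Fin n → Bool) where

  Partition : Set
  Partition = Vec (Vec Bool n) n

  sameCell : Partition → Fin n → Fin n → Bool
  sameCell P v w = lookup (lookup P v) w

  partitionOf : (Fin n → ℕ) → Partition
  partitionOf κ = tabulate λ v → tabulate λ w → does (κ v ℕ.≟ κ w)

  indicator : Bool → ℕ
  indicator b = if b then 1 else 0

  degreeInto : Partition → Fin n → Fin n → ℕ
  degreeInto P v u = sum λ x → indicator (adjacent v x ∧ sameCell P x u)

  profile : Partition → Fin n → Vec ℕ n
  profile P v = tabulate (degreeInto P v)

  sameProfile : Vec ℕ n → Vec ℕ n → Bool
  sameProfile p q = does (≡-dec ℕ._≟_ p q)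

  -- The profiles are an argument so that each round computes them only once.
  refineBy : Vec (Vec ℕ n) n → Partition → Partition
  refineBy profiles P = tabulate λ v → tabulate λ w →
    sameCell P v w ∧ sameProfile (lookup profiles v) (lookup profiles w)

  refine : Partition → Partition
  refine P = refineBy (tabulate (profile P)) P

  refineN : ℕ → Partition → Partition
  refineN zero    P = P
  refineN (suc k) P = refineN k (refine P)

  sameCell-refine : ∀ P v w →
    sameCell (refine P) v w ≡ sameCell P v w ∧ sameProfile (profile P v) (profile P w)
  sameCell-refine P v w = begin
    sameCell (refine P) v w
      ≡⟨ cong (λ row → lookup row w) (lookup∘tabulate _ v) ⟩
    lookup (tabulate λ w → sameCell P v w ∧ sameProfile (lookup ps v) (lookup ps w)) w
      ≡⟨ lookup∘tabulate _ w ⟩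
    sameCell P v w ∧ sameProfile (lookup ps v) (lookup ps w)
      ≡⟨ cong₂ (λ p q → sameCell P v w ∧ sameProfile p q) (lookup∘tabulate _ v) (lookup∘tabulate _ w) ⟩
    sameCell P v w ∧ sameProfile (profile P v) (profile P w) ∎
    where
      open ≡-Reasoning
      ps = tabulate (profile P)

  Reflexive : Partition → Set
  Reflexive P = ∀ v → sameCell P v v ≡ true

  partitionOf-reflexive : ∀ κ → Reflexive (partitionOf κ)
  partitionOf-reflexive κ v = begin
    sameCell (partitionOf κ) v v                  ≡⟨ cong (λ row → lookup row v) (lookup∘tabulate _ v) ⟩
    lookup (tabulate λ w → does (κ v ℕ.≟ κ w)) v  ≡⟨ lookup∘tabulate _ v ⟩
    does (κ v ℕ.≟ κ v)                            ≡⟨ dec-true (κ v ℕ.≟ κ v) refl ⟩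
    true ∎
    where open ≡-Reasoning

  refine-reflexive : ∀ P → Reflexive P → Reflexive (refine P)
  refine-reflexive P P-refl v = begin
    sameCell (refine P) v v
      ≡⟨ sameCell-refine P v v ⟩
    sameCell P v v ∧ sameProfile (profile P v) (profile P v)
      ≡⟨ cong₂ _∧_ (P-refl v) (dec-true (≡-dec ℕ._≟_ (profile P v) (profile P v)) refl) ⟩
    true ∎
    where open ≡-Reasoning

  refineN-reflexive : ∀ k P → Reflexive P → Reflexive (refineN k P)
  refineN-reflexive zero    P P-refl = P-refl
  refineN-reflexive (suc k) P P-refl = refineN-reflexive k (refine P) (refine-reflexive P P-refl)

  Discrete : Partition → Set
  Discrete P = ∀ v w → sameCell P v w ≡ true → v ≡ w

  discrete? : ∀ P → Dec (Discrete P)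
  discrete? P = all? λ v → all? λ w → (sameCell P v w ≟ᵇ true) →-dec (v ≟ᶠ w)

  IsAutomorphism : Permutation′ n → Set
  IsAutomorphism π = ∀ i j → adjacent (π ⟨$⟩ʳ i) (π ⟨$⟩ʳ j) ≡ adjacent i j

  module _ {π : Permutation′ n} (π-automorphism : IsAutomorphism π) where

    Invariant : Partition → Set
    Invariant P = ∀ x y → sameCell P (π ⟨$⟩ʳ x) y ≡ sameCell P x y

    degreeInto-invariant : ∀ P → Invariant P → ∀ v u → degreeInto P (π ⟨$⟩ʳ v) u ≡ degreeInto P v u
    degreeInto-invariant P P-inv v u = begin
      sum (λ x → indicator (adjacent (π ⟨$⟩ʳ v) x ∧ sameCell P x u))
        ≡⟨ sum-permute _ π ⟩
      sum (λ x → indicator (adjacent (π ⟨$⟩ʳ v) (π ⟨$⟩ʳ x) ∧ sameCell P (π ⟨$⟩ʳ x) u))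
        ≡⟨ sum-cong-≗ (λ x → cong indicator (cong₂ _∧_ (π-automorphism v x) (P-inv x u))) ⟩
      sum (λ x → indicator (adjacent v x ∧ sameCell P x u)) ∎
      where open ≡-Reasoning

    refine-invariant : ∀ P → Invariant P → Invariant (refine P)
    refine-invariant P P-inv x y = begin
      sameCell (refine P) (π ⟨$⟩ʳ x) y
        ≡⟨ sameCell-refine P (π ⟨$⟩ʳ x) y ⟩
      sameCell P (π ⟨$⟩ʳ x) y ∧ sameProfile (profile P (π ⟨$⟩ʳ x)) (profile P y)
        ≡⟨ cong₂ (λ b p → b ∧ sameProfile p (profile P y))
                 (P-inv x y) (tabulate-cong (degreeInto-invariant P P-inv x)) ⟩
      sameCell P x y ∧ sameProfile (profile P x) (profile P y)
        ≡⟨ sameCell-refine P x y ⟨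
      sameCell (refine P) x y ∎
      where open ≡-Reasoning

    refineN-invariant : ∀ k P → Invariant P → Invariant (refineN k P)
    refineN-invariant zero    P P-inv = P-inv
    refineN-invariant (suc k) P P-inv = refineN-invariant k (refine P) (refine-invariant P P-inv)

    partitionOf-invariant : ∀ {κ} → (∀ v → κ (π ⟨$⟩ʳ v) ≡ κ v) → Invariant (partitionOf κ)
    partitionOf-invariant {κ} κ-inv x y = begin
      sameCell (partitionOf κ) (π ⟨$⟩ʳ x) y ≡⟨ sameCell-partitionOf (π ⟨$⟩ʳ x) y ⟩
      does (κ (π ⟨$⟩ʳ x) ℕ.≟ κ y)         ≡⟨ cong (λ c → does (c ℕ.≟ κ y)) (κ-inv x) ⟩
      does (κ x ℕ.≟ κ y)                  ≡⟨ sameCell-partitionOf x y ⟨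
      sameCell (partitionOf κ) x y ∎
      where
        open ≡-Reasoning
        sameCell-partitionOf : ∀ v w → sameCell (partitionOf κ) v w ≡ does (κ v ℕ.≟ κ w)
        sameCell-partitionOf v w =
          trans (cong (λ row → lookup row w) (lookup∘tabulate _ v)) (lookup∘tabulate _ w)

    -- π v lies in the cell of π v, hence by invariance in the cell of v.
    fixes-all-if-discrete : ∀ P → Reflexive P → Invariant P → Discrete P → ∀ v → π ⟨$⟩ʳ v ≡ v
    fixes-all-if-discrete P P-refl P-inv P-discrete v =
      sym (P-discrete v (π ⟨$⟩ʳ v) (trans (sym (P-inv v (π ⟨$⟩ʳ v))) (P-refl (π ⟨$⟩ʳ v))))

    refinement-fixes-all : ∀ κ k → Discrete (refineN k (partitionOf κ)) →
      (∀ v → κ (π ⟨$⟩ʳ v) ≡ κ v) → ∀ v → π ⟨$⟩ʳ v ≡ v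
    refinement-fixes-all κ k discrete κ-inv = fixes-all-if-discrete (refineN k (partitionOf κ))
      (refineN-reflexive k (partitionOf κ) (partitionOf-reflexive κ))
      (refineN-invariant k (partitionOf κ) (partitionOf-invariant κ-inv))
      discrete

module _ {n : ℕ} where

  open import Data.List.Membership.DecPropositional (_≟ᶠ_ {n}) using (_∈?_)

  pin : List (Fin n) → Fin n → ℕ
  pin S v = if does (v ∈? S) then suc (toℕ v) else 0

  pin-∉ : ∀ {S : List (Fin n)} {v} → v ∉ S → pin S v ≡ 0
  pin-∉ {S = S} {v} v∉S = cong (λ b → if b then suc (toℕ v) else 0) (dec-false (v ∈? S) v∉S)

  -- A permutation fixing S pointwise maps no vertex outside S into S.
  pin-invariant : ∀ (π : Permutation′ n) {S} → (∀ s → s ∈ S → π ⟨$⟩ʳ s ≡ s) →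
    ∀ v → pin S (π ⟨$⟩ʳ v) ≡ pin S v
  pin-invariant π {S} fixes v = byMembership (v ∈? S)
    where
      byMembership : Dec (v ∈ S) → pin S (π ⟨$⟩ʳ v) ≡ pin S v
      byMembership (yes v∈S) = cong (pin S) (fixes v v∈S)
      byMembership (no  v∉S) = trans (pin-∉ πv∉S) (sym (pin-∉ v∉S))
        where
          πv∉S : π ⟨$⟩ʳ v ∉ S
          πv∉S πv∈S = v∉S (subst (_∈ S) πv≡v πv∈S)
            where
              πv≡v : π ⟨$⟩ʳ v ≡ v
              πv≡v = trans (sym (inverseˡ π)) (trans (cong (π ⟨$⟩ˡ_) (fixes _ πv∈S)) (inverseˡ π))

module _ {V : Set} {Adj : V → V → Set} where

  open Automorphism

  Nontrivial : Automorphism V Adj → Set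
  Nontrivial f = ¬ IsIdentity f

  NontrivialFixer : V → V → Set
  NontrivialFixer a b = Σ (Automorphism V Adj) λ f → Nontrivial f × to f a ≡ a × to f b ≡ b

  Determining-⊆ : ∀ {S S′ : List V} → (∀ {v} → v ∈ S → v ∈ S′) →
    Determining V Adj S → Determining V Adj S′
  Determining-⊆ S⊆S′ S-determining f fixes = S-determining f (λ s s∈S → fixes s (S⊆S′ s∈S))

  ¬Determining-pair : ∀ {a b} → NontrivialFixer a b → ¬ Determining V Adj (a ∷ b ∷ [])
  ¬Determining-pair (f , f-nontrivial , fa≡a , fb≡b) determining = f-nontrivial (determining f fixes)
    where
      fixes : ∀ s → s ∈ _ → to f s ≡ s
      fixes s (here refl)         = fa≡a
      fixes s (there (here refl)) = fb≡b

  determining⇒3≤length : V → (∀ a b → NontrivialFixer a b) → ∀ S → Determining V Adj S → 3 ≤ length S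
  determining⇒3≤length v fixer []              determining =
    ⊥-elim (¬Determining-pair (fixer v v) (Determining-⊆ (λ ()) determining))
  determining⇒3≤length v fixer (a ∷ [])        determining =
    ⊥-elim (¬Determining-pair (fixer a a) (Determining-⊆ (λ { (here refl) → here refl }) determining))
  determining⇒3≤length v fixer (a ∷ b ∷ [])    determining =
    ⊥-elim (¬Determining-pair (fixer a b) determining)
  determining⇒3≤length v fixer (_ ∷ _ ∷ _ ∷ _) _           = s≤s (s≤s (s≤s z≤n))

  ¬Distinguishing-<2 : V → (f : Automorphism V Adj) → Nontrivial f →
    ∀ d → d < 2 → (c : V → Fin d) → ¬ Distinguishing V Adj d c
  ¬Distinguishing-<2 v f f-nontrivial zero          _              c _              = ¬Fin0 (c v)
  ¬Distinguishing-<2 v f f-nontrivial (suc zero)    _              c distinguishing =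
    f-nontrivial (distinguishing f λ u → Fin1-≡ (c (to f u)) (c u))
    where
      Fin1-≡ : (i j : Fin 1) → i ≡ j
      Fin1-≡ zero zero = refl
  ¬Distinguishing-<2 v f f-nontrivial (suc (suc _)) (s≤s (s≤s ())) c _

module FiniteGraph {V : Set} {Adj : V → V → Set} (Adj? : Decidable Adj) {n : ℕ} (index : V ↔ Fin n) where

  open Inverse index public using () renaming (to to indexOf; from to vertexAt)
  open Automorphism

  vertexAt-indexOf : ∀ v → vertexAt (indexOf v) ≡ v
  vertexAt-indexOf v = Inverse.strictlyInverseʳ index v

  indexOf-vertexAt : ∀ i → indexOf (vertexAt i) ≡ i
  indexOf-vertexAt i = Inverse.strictlyInverseˡ index i

  adjacent : Fin n → Fin n → Bool
  adjacent i j = does (Adj? (vertexAt i) (vertexAt j))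

  open ColourRefinement adjacent public

  onIndices : Automorphism V Adj → Permutation′ n
  onIndices f = ↔-trans (↔-sym index) (↔-trans (perm f) index)

  onIndices-isAutomorphism : ∀ f → IsAutomorphism (onIndices f)
  onIndices-isAutomorphism f i j = begin
    does (Adj? (vertexAt (indexOf (to f u))) (vertexAt (indexOf (to f w))))
      ≡⟨ cong₂ (λ x y → does (Adj? x y)) (vertexAt-indexOf (to f u)) (vertexAt-indexOf (to f w)) ⟩
    does (Adj? (to f u) (to f w))
      ≡⟨ does-⇔ (preserves f u w) (Adj? u w) (Adj? (to f u) (to f w)) ⟨
    does (Adj? u w) ∎
    where
      open ≡-Reasoning
      u = vertexAt i
      w = vertexAt j

  isIdentity-onIndices : ∀ f → (∀ i → onIndices f ⟨$⟩ʳ i ≡ i) → IsIdentity f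
  isIdentity-onIndices f fixes v = begin
    to f v                                  ≡⟨ vertexAt-indexOf (to f v) ⟨
    vertexAt (indexOf (to f v))             ≡⟨ cong (vertexAt ∘ indexOf ∘ to f) (vertexAt-indexOf v) ⟨
    vertexAt (onIndices f ⟨$⟩ʳ indexOf v)    ≡⟨ cong vertexAt (fixes (indexOf v)) ⟩
    vertexAt (indexOf v)                    ≡⟨ vertexAt-indexOf v ⟩
    v ∎
    where open ≡-Reasoning

  distinguishing-by-refinement : ∀ {d} (c : V → Fin d) k →
    {True (discrete? (refineN k (partitionOf (toℕ ∘ c ∘ vertexAt))))} → Distinguishing V Adj d c
  distinguishing-by-refinement c k {discrete} f c-preserved = isIdentity-onIndices f
    (refinement-fixes-all {onIndices f} (onIndices-isAutomorphism f) _ k (toWitness discrete)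
      λ i → cong toℕ (trans (cong c (vertexAt-indexOf _)) (c-preserved (vertexAt i))))

  determining-by-refinement : ∀ S k →
    {True (discrete? (refineN k (partitionOf (pin (List.map indexOf S)))))} → Determining V Adj S
  determining-by-refinement S k {discrete} f S-fixed = isIdentity-onIndices f
    (refinement-fixes-all {onIndices f} (onIndices-isAutomorphism f) _ k (toWitness discrete)
      (pin-invariant (onIndices f) indices-fixed))
    where
      indices-fixed : ∀ i → i ∈ List.map indexOf S → onIndices f ⟨$⟩ʳ i ≡ i
      indices-fixed i i∈S with ∈-map⁻ indexOf i∈S
      ... | s , s∈S , refl = cong indexOf (trans (cong (to f) (vertexAt-indexOf s)) (S-fixed s s∈S))

  -- An involution is its own inverse, so a single table certifies a permutation.
  IsInvolutionTable : Vec (Fin n) n → Set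
  IsInvolutionTable t =
    (∀ i → lookup t (lookup t i) ≡ i) ×
    (∀ i j → adjacent (lookup t i) (lookup t j) ≡ adjacent i j) ×
    (∃ λ i → lookup t i ≢ i)

  isInvolutionTable? : ∀ t → Dec (IsInvolutionTable t)
  isInvolutionTable? t =
    all? (λ i → lookup t (lookup t i) ≟ᶠ i) ×-dec
    all? (λ i → all? λ j → adjacent (lookup t i) (lookup t j) ≟ᵇ adjacent i j) ×-dec
    any? (λ i → ¬? (lookup t i ≟ᶠ i))

  record Involution : Set where
    field
      table             : Vec (Fin n) n
      isInvolutionTable : IsInvolutionTable table

  open Involution

  involution : (t : Vec (Fin n) n) → {True (isInvolutionTable? t)} → Involution
  involution t {valid} = record { table = t ; isInvolutionTable = toWitness valid }

  Fixes : Involution → Fin n → Set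
  Fixes s i = lookup (table s) i ≡ i

  Stabilises : Subset n → Involution → Set
  Stabilises p s = ∀ i → lookup p (lookup (table s) i) ≡ lookup p i

  stabilises? : ∀ p s → Dec (Stabilises p s)
  stabilises? p s = all? λ i → lookup p (lookup (table s) i) ≟ᵇ lookup p i

  module _ (s : Involution) where

    private
      act : V → V
      act v = vertexAt (lookup (table s) (indexOf v))

      act-involutive : ∀ v → act (act v) ≡ v
      act-involutive v = begin
        vertexAt (lookup (table s) (indexOf (vertexAt (lookup (table s) (indexOf v)))))
          ≡⟨ cong (vertexAt ∘ lookup (table s)) (indexOf-vertexAt _) ⟩
        vertexAt (lookup (table s) (lookup (table s) (indexOf v)))
          ≡⟨ cong vertexAt (proj₁ (isInvolutionTable s) (indexOf v)) ⟩
        vertexAt (indexOf v)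
          ≡⟨ vertexAt-indexOf v ⟩
        v ∎
        where open ≡-Reasoning

      act-preserves : ∀ u v → Adj u v ⇔ Adj (act u) (act v)
      act-preserves u v = does-≡⇒⇔ (Adj? u v) (Adj? (act u) (act v)) (begin
        does (Adj? u v)
          ≡⟨ cong₂ (λ x y → does (Adj? x y)) (vertexAt-indexOf u) (vertexAt-indexOf v) ⟨
        adjacent (indexOf u) (indexOf v)
          ≡⟨ proj₁ (proj₂ (isInvolutionTable s)) (indexOf u) (indexOf v) ⟨
        does (Adj? (act u) (act v)) ∎)
        where open ≡-Reasoning

    automorphism : Automorphism V Adj
    automorphism = record
      { perm      = mk↔ₛ′ act act act-involutive act-involutive
      ; preserves = act-preserves
      }

    automorphism-nontrivial : Nontrivial automorphism
    automorphism-nontrivial identity = moved (begin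
      lookup (table s) i                       ≡⟨ cong (lookup (table s)) (indexOf-vertexAt i) ⟨
      lookup (table s) (indexOf (vertexAt i))  ≡⟨ indexOf-vertexAt _ ⟨
      indexOf (act (vertexAt i))               ≡⟨ cong indexOf (identity (vertexAt i)) ⟩
      indexOf (vertexAt i)                     ≡⟨ indexOf-vertexAt i ⟩
      i ∎)
      where
        open ≡-Reasoning
        i = proj₁ (proj₂ (proj₂ (isInvolutionTable s)))
        moved = proj₂ (proj₂ (proj₂ (isInvolutionTable s)))

    automorphism-fixes : ∀ v → Fixes s (indexOf v) → to automorphism v ≡ v
    automorphism-fixes v fixed = trans (cong vertexAt fixed) (vertexAt-indexOf v)

  nontrivialFixer : ∀ {a b} → ∃ (λ s → Fixes s (indexOf a) × Fixes s (indexOf b)) → NontrivialFixer a b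
  nontrivialFixer {a} {b} (s , a-fixed , b-fixed) =
    automorphism s , automorphism-nontrivial s , automorphism-fixes s a a-fixed , automorphism-fixes s b b-fixed

  hasColour : ∀ {d} → (V → Fin d) → Fin d → Fin n → Bool
  hasColour c i j = does (c (vertexAt j) ≟ᶠ i)

  colourClass : ∀ {d} → (V → Fin d) → Fin d → Subset n
  colourClass c i = tabulate (hasColour c i)

  stabilises⇒preserves : ∀ (c : V → Fin 2) i s → Stabilises (colourClass c i) s →
    ∀ v → c (to (automorphism s) v) ≡ c v
  stabilises⇒preserves c i s stable v = Fin2-≡-by-membership i (begin
    does (c (vertexAt (lookup (table s) (indexOf v))) ≟ᶠ i)
      ≡⟨ lookup∘tabulate (hasColour c i) (lookup (table s) (indexOf v)) ⟨
    lookup (colourClass c i) (lookup (table s) (indexOf v))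
      ≡⟨ stable (indexOf v) ⟩
    lookup (colourClass c i) (indexOf v)
      ≡⟨ lookup∘tabulate (hasColour c i) (indexOf v) ⟩
    does (c (vertexAt (indexOf v)) ≟ᶠ i)
      ≡⟨ cong (λ x → does (c x ≟ᶠ i)) (vertexAt-indexOf v) ⟩
    does (c v ≟ᶠ i) ∎)
    where open ≡-Reasoning

  stabilised⇒¬distinguishing : ∀ (c : V → Fin 2) i → ∃ (Stabilises (colourClass c i)) →
    ¬ Distinguishing V Adj 2 c
  stabilised⇒¬distinguishing c i (s , stable) distinguishing =
    automorphism-nontrivial s (distinguishing (automorphism s) (stabilises⇒preserves c i s stable))

open FiniteGraph (pxAdj? 4 2) (vertex↔Fin 4 2)
open Involution

_≟ᵛ_ : DecidableEquality (Vertex 4 2)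
_≟ᵛ_ = ×-≡-dec _≟ᶠ_ (≡-dec _≟ᵇ_)

pinned : List (Vertex 4 2)
pinned = (# 0 , false ∷ false ∷ []) ∷ (# 0 , false ∷ true ∷ []) ∷ (# 2 , false ∷ false ∷ []) ∷ []

pinned-unique : Unique pinned
pinned-unique = ((λ ()) ∷ (λ ()) ∷ []) ∷ ((λ ()) ∷ []) ∷ [] ∷ []

pinned-determining : Determining (Vertex 4 2) (PXAdj 4 2) pinned
pinned-determining = determining-by-refinement pinned 2

red : List (Vertex 4 2)
red = (# 0 , true ∷ false ∷ []) ∷ (# 0 , false ∷ true ∷ []) ∷ (# 0 , false ∷ false ∷ [])
    ∷ (# 1 , false ∷ false ∷ []) ∷ (# 2 , true ∷ false ∷ []) ∷ []

redBlue : Vertex 4 2 → Fin 2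
redBlue v = if does (Any.any? (v ≟ᵛ_) red) then # 1 else # 0

redBlue-distinguishing : Distinguishing (Vertex 4 2) (PXAdj 4 2) 2 redBlue
redBlue-distinguishing = distinguishing-by-refinement redBlue 3

-- Chosen by a greedy set cover, among the involutions of the automorphism group (of order 384),
-- of the fixing and stabilising requirements below.
involutions : List Involution
involutions =
  involution (# 0 ∷ # 1 ∷ # 2 ∷ # 3 ∷ # 4 ∷ # 5 ∷ # 6 ∷ # 7 ∷ # 9 ∷ # 8 ∷ # 11 ∷ # 10 ∷ # 14 ∷ # 15 ∷ # 12 ∷ # 13 ∷ [])
  ∷ involution (# 0 ∷ # 1 ∷ # 2 ∷ # 3 ∷ # 5 ∷ # 4 ∷ # 7 ∷ # 6 ∷ # 10 ∷ # 11 ∷ # 8 ∷ # 9 ∷ # 12 ∷ # 13 ∷ # 14 ∷ # 15 ∷ [])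
  ∷ involution (# 0 ∷ # 8 ∷ # 11 ∷ # 3 ∷ # 14 ∷ # 5 ∷ # 6 ∷ # 13 ∷ # 1 ∷ # 9 ∷ # 10 ∷ # 2 ∷ # 12 ∷ # 7 ∷ # 4 ∷ # 15 ∷ [])
  ∷ involution (# 0 ∷ # 9 ∷ # 10 ∷ # 3 ∷ # 12 ∷ # 5 ∷ # 6 ∷ # 15 ∷ # 8 ∷ # 1 ∷ # 2 ∷ # 11 ∷ # 4 ∷ # 13 ∷ # 14 ∷ # 7 ∷ [])
  ∷ involution (# 0 ∷ # 10 ∷ # 9 ∷ # 3 ∷ # 4 ∷ # 14 ∷ # 13 ∷ # 7 ∷ # 8 ∷ # 2 ∷ # 1 ∷ # 11 ∷ # 12 ∷ # 6 ∷ # 5 ∷ # 15 ∷ [])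
  ∷ involution (# 0 ∷ # 11 ∷ # 8 ∷ # 3 ∷ # 4 ∷ # 12 ∷ # 15 ∷ # 7 ∷ # 2 ∷ # 9 ∷ # 10 ∷ # 1 ∷ # 5 ∷ # 13 ∷ # 14 ∷ # 6 ∷ [])
  ∷ involution (# 1 ∷ # 0 ∷ # 3 ∷ # 2 ∷ # 6 ∷ # 7 ∷ # 4 ∷ # 5 ∷ # 8 ∷ # 9 ∷ # 10 ∷ # 11 ∷ # 12 ∷ # 13 ∷ # 14 ∷ # 15 ∷ [])
  ∷ involution (# 2 ∷ # 3 ∷ # 0 ∷ # 1 ∷ # 4 ∷ # 5 ∷ # 6 ∷ # 7 ∷ # 8 ∷ # 9 ∷ # 10 ∷ # 11 ∷ # 13 ∷ # 12 ∷ # 15 ∷ # 14 ∷ [])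
  ∷ involution (# 4 ∷ # 6 ∷ # 5 ∷ # 7 ∷ # 0 ∷ # 2 ∷ # 1 ∷ # 3 ∷ # 14 ∷ # 12 ∷ # 15 ∷ # 13 ∷ # 9 ∷ # 11 ∷ # 8 ∷ # 10 ∷ [])
  ∷ involution (# 4 ∷ # 13 ∷ # 14 ∷ # 7 ∷ # 0 ∷ # 9 ∷ # 10 ∷ # 3 ∷ # 12 ∷ # 5 ∷ # 6 ∷ # 15 ∷ # 8 ∷ # 1 ∷ # 2 ∷ # 11 ∷ [])
  ∷ involution (# 4 ∷ # 15 ∷ # 12 ∷ # 7 ∷ # 0 ∷ # 8 ∷ # 11 ∷ # 3 ∷ # 5 ∷ # 14 ∷ # 13 ∷ # 6 ∷ # 2 ∷ # 10 ∷ # 9 ∷ # 1 ∷ [])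
  ∷ involution (# 5 ∷ # 7 ∷ # 4 ∷ # 6 ∷ # 2 ∷ # 0 ∷ # 3 ∷ # 1 ∷ # 15 ∷ # 13 ∷ # 14 ∷ # 12 ∷ # 11 ∷ # 9 ∷ # 10 ∷ # 8 ∷ [])
  ∷ involution (# 5 ∷ # 13 ∷ # 14 ∷ # 6 ∷ # 11 ∷ # 0 ∷ # 3 ∷ # 8 ∷ # 7 ∷ # 15 ∷ # 12 ∷ # 4 ∷ # 10 ∷ # 1 ∷ # 2 ∷ # 9 ∷ [])
  ∷ involution (# 5 ∷ # 15 ∷ # 12 ∷ # 6 ∷ # 10 ∷ # 0 ∷ # 3 ∷ # 9 ∷ # 13 ∷ # 7 ∷ # 4 ∷ # 14 ∷ # 2 ∷ # 8 ∷ # 11 ∷ # 1 ∷ [])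
  ∷ involution (# 6 ∷ # 4 ∷ # 7 ∷ # 5 ∷ # 1 ∷ # 3 ∷ # 0 ∷ # 2 ∷ # 12 ∷ # 14 ∷ # 13 ∷ # 15 ∷ # 8 ∷ # 10 ∷ # 9 ∷ # 11 ∷ [])
  ∷ involution (# 6 ∷ # 12 ∷ # 15 ∷ # 5 ∷ # 9 ∷ # 3 ∷ # 0 ∷ # 10 ∷ # 14 ∷ # 4 ∷ # 7 ∷ # 13 ∷ # 1 ∷ # 11 ∷ # 8 ∷ # 2 ∷ [])
  ∷ involution (# 6 ∷ # 14 ∷ # 13 ∷ # 5 ∷ # 8 ∷ # 3 ∷ # 0 ∷ # 11 ∷ # 4 ∷ # 12 ∷ # 15 ∷ # 7 ∷ # 9 ∷ # 2 ∷ # 1 ∷ # 10 ∷ [])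
  ∷ involution (# 7 ∷ # 5 ∷ # 6 ∷ # 4 ∷ # 3 ∷ # 1 ∷ # 2 ∷ # 0 ∷ # 13 ∷ # 15 ∷ # 12 ∷ # 14 ∷ # 10 ∷ # 8 ∷ # 11 ∷ # 9 ∷ [])
  ∷ involution (# 7 ∷ # 12 ∷ # 15 ∷ # 4 ∷ # 3 ∷ # 11 ∷ # 8 ∷ # 0 ∷ # 6 ∷ # 13 ∷ # 14 ∷ # 5 ∷ # 1 ∷ # 9 ∷ # 10 ∷ # 2 ∷ [])
  ∷ involution (# 7 ∷ # 14 ∷ # 13 ∷ # 4 ∷ # 3 ∷ # 10 ∷ # 9 ∷ # 0 ∷ # 15 ∷ # 6 ∷ # 5 ∷ # 12 ∷ # 11 ∷ # 2 ∷ # 1 ∷ # 8 ∷ [])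
  ∷ involution (# 8 ∷ # 1 ∷ # 2 ∷ # 11 ∷ # 4 ∷ # 13 ∷ # 14 ∷ # 7 ∷ # 0 ∷ # 9 ∷ # 10 ∷ # 3 ∷ # 12 ∷ # 5 ∷ # 6 ∷ # 15 ∷ [])
  ∷ involution (# 9 ∷ # 1 ∷ # 2 ∷ # 10 ∷ # 4 ∷ # 15 ∷ # 12 ∷ # 7 ∷ # 8 ∷ # 0 ∷ # 3 ∷ # 11 ∷ # 6 ∷ # 13 ∷ # 14 ∷ # 5 ∷ [])
  ∷ involution (# 10 ∷ # 1 ∷ # 2 ∷ # 9 ∷ # 13 ∷ # 5 ∷ # 6 ∷ # 14 ∷ # 8 ∷ # 3 ∷ # 0 ∷ # 11 ∷ # 12 ∷ # 4 ∷ # 7 ∷ # 15 ∷ [])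
  ∷ involution (# 11 ∷ # 1 ∷ # 2 ∷ # 8 ∷ # 15 ∷ # 5 ∷ # 6 ∷ # 12 ∷ # 3 ∷ # 9 ∷ # 10 ∷ # 0 ∷ # 7 ∷ # 13 ∷ # 14 ∷ # 4 ∷ [])
  ∷ involution (# 12 ∷ # 4 ∷ # 7 ∷ # 15 ∷ # 1 ∷ # 10 ∷ # 9 ∷ # 2 ∷ # 14 ∷ # 6 ∷ # 5 ∷ # 13 ∷ # 0 ∷ # 11 ∷ # 8 ∷ # 3 ∷ [])
  ∷ involution (# 12 ∷ # 5 ∷ # 6 ∷ # 15 ∷ # 8 ∷ # 1 ∷ # 2 ∷ # 11 ∷ # 4 ∷ # 13 ∷ # 14 ∷ # 7 ∷ # 0 ∷ # 9 ∷ # 10 ∷ # 3 ∷ [])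
  ∷ involution (# 12 ∷ # 14 ∷ # 13 ∷ # 15 ∷ # 10 ∷ # 8 ∷ # 11 ∷ # 9 ∷ # 5 ∷ # 7 ∷ # 4 ∷ # 6 ∷ # 0 ∷ # 2 ∷ # 1 ∷ # 3 ∷ [])
  ∷ involution (# 13 ∷ # 6 ∷ # 5 ∷ # 14 ∷ # 10 ∷ # 2 ∷ # 1 ∷ # 9 ∷ # 12 ∷ # 7 ∷ # 4 ∷ # 15 ∷ # 8 ∷ # 0 ∷ # 3 ∷ # 11 ∷ [])
  ∷ involution (# 13 ∷ # 7 ∷ # 4 ∷ # 14 ∷ # 2 ∷ # 8 ∷ # 11 ∷ # 1 ∷ # 5 ∷ # 15 ∷ # 12 ∷ # 6 ∷ # 10 ∷ # 0 ∷ # 3 ∷ # 9 ∷ [])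
  ∷ involution (# 13 ∷ # 15 ∷ # 12 ∷ # 14 ∷ # 8 ∷ # 10 ∷ # 9 ∷ # 11 ∷ # 4 ∷ # 6 ∷ # 5 ∷ # 7 ∷ # 2 ∷ # 0 ∷ # 3 ∷ # 1 ∷ [])
  ∷ involution (# 14 ∷ # 4 ∷ # 7 ∷ # 13 ∷ # 1 ∷ # 11 ∷ # 8 ∷ # 2 ∷ # 6 ∷ # 12 ∷ # 15 ∷ # 5 ∷ # 9 ∷ # 3 ∷ # 0 ∷ # 10 ∷ [])
  ∷ involution (# 14 ∷ # 5 ∷ # 6 ∷ # 13 ∷ # 9 ∷ # 1 ∷ # 2 ∷ # 10 ∷ # 15 ∷ # 4 ∷ # 7 ∷ # 12 ∷ # 11 ∷ # 3 ∷ # 0 ∷ # 8 ∷ [])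
  ∷ involution (# 14 ∷ # 12 ∷ # 15 ∷ # 13 ∷ # 11 ∷ # 9 ∷ # 10 ∷ # 8 ∷ # 7 ∷ # 5 ∷ # 6 ∷ # 4 ∷ # 1 ∷ # 3 ∷ # 0 ∷ # 2 ∷ [])
  ∷ involution (# 15 ∷ # 6 ∷ # 5 ∷ # 12 ∷ # 11 ∷ # 2 ∷ # 1 ∷ # 8 ∷ # 7 ∷ # 14 ∷ # 13 ∷ # 4 ∷ # 3 ∷ # 10 ∷ # 9 ∷ # 0 ∷ [])
  ∷ involution (# 15 ∷ # 7 ∷ # 4 ∷ # 12 ∷ # 2 ∷ # 9 ∷ # 10 ∷ # 1 ∷ # 13 ∷ # 5 ∷ # 6 ∷ # 14 ∷ # 3 ∷ # 8 ∷ # 11 ∷ # 0 ∷ [])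
  ∷ involution (# 15 ∷ # 13 ∷ # 14 ∷ # 12 ∷ # 9 ∷ # 11 ∷ # 8 ∷ # 10 ∷ # 6 ∷ # 4 ∷ # 7 ∷ # 5 ∷ # 3 ∷ # 1 ∷ # 2 ∷ # 0 ∷ [])
  ∷ []

pairs-fixed : ∀ i j → Any (λ s → Fixes s i × Fixes s j) involutions
pairs-fixed = from-yes (all? λ i → all? λ j →
  Any.any? (λ s → (lookup (table s) i ≟ᶠ i) ×-dec (lookup (table s) j ≟ᶠ j)) involutions)

small-sets-stabilised : ∀ p → ∣ p ∣ ≤ 4 → Any (Stabilises p) involutions
small-sets-stabilised = from-yes (all-of-size≤? (λ p → Any.any? (stabilises? p) involutions) 4)

classSize≡∣colourClass∣ : ∀ c i → classSize 4 2 c i ≡ ∣ colourClass c i ∣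
classSize≡∣colourClass∣ c i = length-filter-tabulate (λ v → c v ≟ᶠ i) vertexAt

distinguishing⇒5≤classSize : ∀ c → Distinguishing (Vertex 4 2) (PXAdj 4 2) 2 c →
  ∀ i → 5 ≤ classSize 4 2 c i
distinguishing⇒5≤classSize c distinguishing i = ≰⇒> not-small
  where
    not-small : ¬ classSize 4 2 c i ≤ 4
    not-small small = stabilised⇒¬distinguishing c i
      (Any.satisfied (small-sets-stabilised (colourClass c i) (subst (_≤ 4) (classSize≡∣colourClass∣ c i) small)))
      distinguishing

pair-fixer : ∀ a b → NontrivialFixer {Adj = PXAdj 4 2} a b
pair-fixer a b = nontrivialFixer (Any.satisfied (pairs-fixed (indexOf a) (indexOf b)))

proposition4p3 : DetEq (Vertex 4 2) (PXAdj 4 2) 3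
    × DistEq (Vertex 4 2) (PXAdj 4 2) 2
    × RhoEq 4 2 5
proposition4p3 =
  ( (pinned , pinned-unique , refl , pinned-determining)
  , λ S _ → determining⇒3≤length v₀ pair-fixer S )
  , ( (redBlue , redBlue-distinguishing)
    , ¬Distinguishing-<2 v₀ (proj₁ (pair-fixer v₀ v₀)) (proj₁ (proj₂ (pair-fixer v₀ v₀))) )
  , ( (redBlue , redBlue-distinguishing , # 1 , refl)
    , distinguishing⇒5≤classSize )
  where
    v₀ : Vertex 4 2
    v₀ = # 0 , true ∷ true ∷ []
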